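{- In a tree $T$, every FD-set of minimum cardinality $\operatorname{fd}(T)$ is a 1-fair dominating set.
   Context: All graphs are finite and simple; $N(v)$ denotes the open neighborhood of $v$. For a graph $G=(V,E)$ and an integer $k \ge 1$, a $k$-fair dominating set is a dominating set $D \subseteq V$ such that $|N(v) \cap D| = k$ for every $v \in V \setminus D$ (the set $D = V$ qualifies vacuously). A fair dominating set (FD-set) is a set that is a $k$-fair dominating set for some $k \ge 1$. If $G$ has at least one edge, $\operatorname{fd}(G)$ is the minimum cardinality of an FD-set of $G$; by convention, $\operatorname{fd}(\overline{K_n}) = n$. -}

module Defs where

open import Data.Nat using (ℕ; _≤_; _≥_)
open import Data.Bool using (Bool; true; false)
open import Data.Fin using (Fin)
open import Data.Fin.Subset using (Subset; _∈_; _∉_; _∩_; ∣_∣)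
open import Data.Vec using (tabulate)
open import Data.List using (List; []; _∷_; _++_; [_]; length)
open import Data.List.Relation.Unary.Unique.Propositional using (Unique)
open import Data.Product using (Σ; _×_; ∃; ∃-syntax)
open import Data.Unit using (⊤)
open import Relation.Nullary using (¬_)
open import Relation.Binary.PropositionalEquality using (_≡_)

record Graph (n : ℕ) : Set where
  field
    adj   : Fin n → Fin n → Bool
    sym   : ∀ u v → adj u v ≡ adj v u
    irrfl : ∀ v → adj v v ≡ false

module _ {n : ℕ} (G : Graph n) where
  open Graph G

  Edge : Fin n → Fin n → Set
  Edge u v = adj u v ≡ true

  N : Fin n → Subset n
  N v = tabulate (adj v)

  data Reach : Fin n → Fin n → Set where
    here : ∀ {v} → Reach v v
    step : ∀ {u w v} → Edge u w → Reach w v → Reach u v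

  Connected : Set
  Connected = ∀ u v → Reach u v

  Chain : List (Fin n) → Set
  Chain []           = ⊤
  Chain (x ∷ [])     = ⊤
  Chain (x ∷ y ∷ zs) = Edge x y × Chain (y ∷ zs)

  HasCycle : Set
  HasCycle = Σ (Fin n) λ x → Σ (List (Fin n)) λ ys →
    (2 ≤ length ys) × Unique (x ∷ ys) × Chain (x ∷ ys ++ [ x ])

  IsTree : Set
  IsTree = Connected × ¬ HasCycle

  Dominating : Subset n → Set
  Dominating D = ∀ v → v ∉ D → ∃[ u ] (u ∈ D × Edge v u)

  IsKFair : ℕ → Subset n → Set
  IsKFair k D = Dominating D × (∀ v → v ∉ D → ∣ N v ∩ D ∣ ≡ k)

  IsFD : Subset n → Set
  IsFD D = ∃[ k ] (k ≥ 1 × IsKFair k D)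

  IsMinFD : Subset n → Set
  IsMinFD D = IsFD D × (∀ D′ → IsFD D′ → ∣ D ∣ ≤ ∣ D′ ∣)

-- Suppose a minimum FD-set D of the tree T is k-fair with k ≥ 2, and let s = |V ∖ D| ≥ 1.
-- The s·k edges between V ∖ D and D lie in a forest, so s·k ≤ n − 1, whence 2s < n.
-- On the other hand, every forest without isolated vertices has a 1-fair dominating set
-- containing at most half of its vertices. Near the end of a longest path sits a support vertex
-- all of whose neighbours except its parent are leaves. Deleting at least two vertices (the star
-- around it, its leaves, or the support vertex with its only leaf), recursing, and adding one
-- vertex to the 1-fair dominating set found for the rest pays one vertex for every two deleted.
-- By minimality |D| ≤ n/2, so n = |D| + s gives n ≤ 2s, a contradiction.
module Submission where

open import Data.Bool using (Bool; true; false; _∧_; _∨_; not)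
import Data.Bool.Properties as Bool
open import Data.Empty using (⊥; ⊥-elim)
open import Data.Fin using (Fin; zero; suc; _≟_)
open import Data.Fin.Properties using (any?; toℕ<n)
open import Data.Fin.Subset using (Subset)
import Data.Fin.Subset as Sub
open import Data.List using (List; []; _∷_; _++_; [_]; length)
open import Data.List.Membership.Propositional using () renaming (_∈_ to _∈ˡ_; _∉_ to _∉ˡ_)
open import Data.List.Membership.Propositional.Properties using (∈-∃++)
open import Data.List.Properties using (++-assoc; length-++-≤ʳ)
import Data.List.Relation.Unary.All.Properties as All
open import Data.List.Relation.Unary.All using ([]; _∷_)
open import Data.List.Relation.Unary.AllPairs using ([]; _∷_)
open import Data.List.Relation.Unary.Any using (here; there)
open import Data.List.Relation.Unary.Unique.Propositional using (Unique; tail)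
open import Data.Nat using (ℕ; zero; suc; _+_; _*_; _∸_; _≤_; _<_; z≤n; s≤s)
open import Data.Nat.Induction using (<-wellFounded)
import Data.Nat.Properties as ℕ
open import Data.Nat.Properties
  using ( ≤-refl; ≤-reflexive; ≤-trans; ≤-antisym; ≤-pred; n≤1+n; 1+n≰n; <⇒≱; ≤∧≢⇒<
        ; m≤m+n; m≤n+m; m∸n≤m
        ; +-comm; +-suc; +-identityʳ; +-mono-≤; +-monoˡ-≤; +-monoʳ-≤; +-cancelˡ-≤
        ; *-comm; *-identityˡ; *-mono-≤; *-monoʳ-≤; module ≤-Reasoning)
open import Data.Product using (∃; _×_; _,_; proj₁; proj₂)
open import Data.Sum using (_⊎_; inj₁; inj₂)
open import Data.Unit using (tt)
open import Data.Vec using ([]; _∷_; lookup; tabulate)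
open import Data.Vec.Properties using (lookup-zipWith; lookup∘tabulate; []=⇒lookup; lookup⇒[]=)
open import Function using (_∘_; _$_)
open import Induction.WellFounded using (Acc; acc)
open import Relation.Binary.PropositionalEquality
  using (_≡_; _≢_; _≗_; refl; sym; trans; cong; cong₂; subst; subst₂; module ≡-Reasoning)
open import Relation.Nullary using (Dec; yes; no; does; ¬_)
open import Relation.Nullary.Decidable using (dec-true; _×-dec_; ¬?)

open import Defs
open import Algebra.Properties.Semiring.Sum ℕ.+-*-semiring
  using (sum; ∑-distrib-+; sum-cong-≗; *-distribʳ-sum; sum-replicate-zero)

private variable
  n : ℕ

≤∸1⇒< : {m n : ℕ} → m ≤ n ∸ 1 → 1 ≤ n → m < n
≤∸1⇒< m≤n∸1 (s≤s _) = s≤s m≤n∸1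

m∸1+n≤m : {m n : ℕ} → n ≤ 1 → n ≤ m → m ∸ 1 + n ≤ m
m∸1+n≤m {m} z≤n _ = ≤-trans (≤-reflexive (+-identityʳ _)) (m∸n≤m m 1)
m∸1+n≤m {suc m} (s≤s z≤n) _ = ≤-reflexive (+-comm m 1)

sum-mono-≤ : {f g : Fin n → ℕ} → (∀ i → f i ≤ g i) → sum f ≤ sum g
sum-mono-≤ {zero} f≤g = z≤n
sum-mono-≤ {suc n} f≤g = +-mono-≤ (f≤g zero) (sum-mono-≤ (f≤g ∘ suc))

-- Vertex sets and counting

VSet : ℕ → Set
VSet n = Fin n → Bool

infix 4 _∈_ _∉_ _⊆_ _∈?_
infixl 7 _∩_
infixl 6 _∪_ _─_ _-_

-- Membership is a record, and the set operations and `count` below are opaque, so that Agda can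
-- infer the sets involved from a membership proof instead of getting stuck on unfolded Booleans.
record _∈_ (x : Fin n) (U : VSet n) : Set where
  constructor mem
  field unmem : U x ≡ true
open _∈_ public

_∉_ : Fin n → VSet n → Set
x ∉ U = ¬ x ∈ U

_⊆_ : VSet n → VSet n → Set
P ⊆ U = ∀ {x} → x ∈ P → x ∈ U

full : VSet n
full _ = true

false⇒∉ : {U : VSet n} {x : Fin n} → U x ≡ false → x ∉ U
false⇒∉ Ux≡false (mem Ux≡true) with () ← trans (sym Ux≡true) Ux≡false

∉⇒false : {U : VSet n} {x : Fin n} → x ∉ U → U x ≡ false
∉⇒false {U = U} {x} x∉U with U x in Ux
... | true = ⊥-elim (x∉U (mem Ux))
... | false = refl

_∈?_ : (x : Fin n) (U : VSet n) → Dec (x ∈ U)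
x ∈? U with U x in Ux
... | true = yes (mem Ux)
... | false = no (false⇒∉ Ux)

bit : Bool → ℕ
bit true = 1
bit false = 0

bit≤1 : (b : Bool) → bit b ≤ 1
bit≤1 true = ≤-refl
bit≤1 false = z≤n

bit-∈ : {U : VSet n} {x : Fin n} → x ∈ U → bit (U x) ≡ 1
bit-∈ (mem Ux) = cong bit Ux

bit-∉ : {U : VSet n} {x : Fin n} → x ∉ U → bit (U x) ≡ 0
bit-∉ x∉U = cong bit (∉⇒false x∉U)

bit-mono : {P Q : VSet n} {x : Fin n} → (x ∈ P → x ∈ Q) → bit (P x) ≤ bit (Q x)
bit-mono {P = P} {x = x} P⇒Q with P x in Px
... | false = z≤n
... | true rewrite unmem (P⇒Q (mem Px)) = ≤-refl

opaque
  _∩_ _∪_ _─_ : VSet n → VSet n → VSet n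
  (U ∩ W) x = U x ∧ W x
  (U ∪ W) x = U x ∨ W x
  (U ─ W) x = U x ∧ not (W x)

  ⁅_⁆ : Fin n → VSet n
  ⁅ x ⁆ y = does (y ≟ x)

  count : VSet n → ℕ
  count U = sum (bit ∘ U)

_-_ : VSet n → Fin n → VSet n
U - x = U ─ ⁅ x ⁆

opaque
  unfolding count

  x∈⁅x⁆ : (x : Fin n) → x ∈ ⁅ x ⁆
  x∈⁅x⁆ x = mem (dec-true (x ≟ x) refl)

  x∈⁅y⁆⇒x≡y : {x y : Fin n} → x ∈ ⁅ y ⁆ → x ≡ y
  x∈⁅y⁆⇒x≡y {x = x} {y} (mem x∈⁅y⁆) with x ≟ y
  ... | yes x≡y = x≡y
  ... | no _ with () ← x∈⁅y⁆

  ∈∩⁺ : {U W : VSet n} {x : Fin n} → x ∈ U → x ∈ W → x ∈ U ∩ W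
  ∈∩⁺ (mem Ux) (mem Wx) = mem (cong₂ _∧_ Ux Wx)

  ∈∩⁻ : {U W : VSet n} {x : Fin n} → x ∈ U ∩ W → x ∈ U × x ∈ W
  ∈∩⁻ (mem UWx) = mem (Bool.∧-conicalˡ _ _ UWx) , mem (Bool.∧-conicalʳ _ _ UWx)

  ∈─⁺ : {U W : VSet n} {x : Fin n} → x ∈ U → x ∉ W → x ∈ U ─ W
  ∈─⁺ (mem Ux) x∉W = mem (cong₂ (λ a b → a ∧ not b) Ux (∉⇒false x∉W))

  ∈─⁻ : {U W : VSet n} {x : Fin n} → x ∈ U ─ W → x ∈ U × x ∉ W
  ∈─⁻ {W = W} {x} (mem UWx) =
    mem (Bool.∧-conicalˡ _ _ UWx) ,
    false⇒∉ (trans (sym (Bool.not-involutive (W x))) (cong not (Bool.∧-conicalʳ _ _ UWx)))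

  ∈∪ˡ : {U W : VSet n} {x : Fin n} → x ∈ U → x ∈ U ∪ W
  ∈∪ˡ {W = W} {x} (mem Ux) = mem (cong (_∨ W x) Ux)

  ∈∪ʳ : {U W : VSet n} {x : Fin n} → x ∈ W → x ∈ U ∪ W
  ∈∪ʳ {U = U} {x = x} (mem Wx) = mem (trans (cong (U x ∨_) Wx) (Bool.∨-zeroʳ (U x)))

  ∈∪⁻ : {U W : VSet n} {x : Fin n} → x ∈ U ∪ W → x ∈ U ⊎ x ∈ W
  ∈∪⁻ {U = U} {x = x} (mem UWx) with U x in Ux
  ... | true = inj₁ (mem Ux)
  ... | false = inj₂ (mem UWx)

  count≡sum : (U : VSet n) → count U ≡ sum (bit ∘ U)
  count≡sum U = refl

  count-cong : {U W : VSet n} → U ≗ W → count U ≡ count W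
  count-cong U≗W = sum-cong-≗ (cong bit ∘ U≗W)

  count-mono : {P U : VSet n} → P ⊆ U → count P ≤ count U
  count-mono {P = P} P⊆U = sum-mono-≤ {f = bit ∘ P} λ _ → bit-mono P⊆U

  count≤n : (U : VSet n) → count U ≤ n
  count≤n {zero} U = z≤n
  count≤n {suc n} U = +-mono-≤ (bit≤1 (U zero)) (count≤n (U ∘ suc))

  count-none : {U : VSet n} → (∀ x → x ∉ U) → count U ≡ 0
  count-none {zero} _ = refl
  count-none {suc n} none rewrite ∉⇒false (none zero) = count-none λ x (mem Ux) → none (suc x) (mem Ux)

  count-full : count (full {n}) ≡ n
  count-full {zero} = refl
  count-full {suc n} = cong suc (count-full {n})

  count-nonempty : {U : VSet n} → 1 ≤ count U → ∃ (_∈ U)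
  count-nonempty {suc n} {U} 1≤count with U zero in U0
  ... | true = zero , mem U0
  ... | false with x , mem Ux ← count-nonempty {U = U ∘ suc} 1≤count = suc x , mem Ux

  count-⁅⁆ : (x : Fin n) → count ⁅ x ⁆ ≡ 1
  count-⁅⁆ {suc n} zero = cong suc (count-none {n} {⁅ zero ⁆ ∘ suc} λ _ → false⇒∉ refl)
  count-⁅⁆ {suc n} (suc x) = trans (count-cong ⁅x⁆∘suc) (count-⁅⁆ x)
    where
    ⁅x⁆∘suc : ⁅ suc x ⁆ ∘ suc ≗ ⁅ x ⁆
    ⁅x⁆∘suc y with y ≟ x
    ... | yes _ = refl
    ... | no _ = refl

  count-partition : (U X : VSet n) → count U ≡ count (U ─ X) + count (U ∩ X)
  count-partition U X =
    trans (sum-cong-≗ λ x → split (U x) (X x)) (∑-distrib-+ (bit ∘ (U ─ X)) (bit ∘ (U ∩ X)))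
    where
    split : ∀ u a → bit u ≡ bit (u ∧ not a) + bit (u ∧ a)
    split true true = refl
    split true false = refl
    split false _ = refl

  count-∪ : (U W : VSet n) → count (U ∪ W) ≤ count U + count W
  count-∪ U W =
    ≤-trans (sum-mono-≤ λ x → bit-∨ (U x) (W x)) (≤-reflexive (∑-distrib-+ (bit ∘ U) (bit ∘ W)))
    where
    bit-∨ : ∀ a b → bit (a ∨ b) ≤ bit a + bit b
    bit-∨ true _ = s≤s z≤n
    bit-∨ false _ = ≤-refl

  count-∁ : (U : VSet n) → count U + count (not ∘ U) ≡ n
  count-∁ {zero} U = refl
  count-∁ {suc n} U with U zero
  ... | true = cong suc (count-∁ (U ∘ suc))
  ... | false = trans (+-suc _ _) (cong suc (count-∁ (U ∘ suc)))

  ∣p∣≡count : (p : Subset n) → Sub.∣ p ∣ ≡ count (lookup p)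
  ∣p∣≡count [] = refl
  ∣p∣≡count (true ∷ p) = cong suc (∣p∣≡count p)
  ∣p∣≡count (false ∷ p) = ∣p∣≡count p

x≡y⇒x∈⁅y⁆ : {x y : Fin n} → x ≡ y → x ∈ ⁅ y ⁆
x≡y⇒x∈⁅y⁆ refl = x∈⁅x⁆ _

x≢y⇒x∉⁅y⁆ : {x y : Fin n} → x ≢ y → x ∉ ⁅ y ⁆
x≢y⇒x∉⁅y⁆ x≢y = x≢y ∘ x∈⁅y⁆⇒x≡y

∉∪⁺ : {U W : VSet n} {x : Fin n} → x ∉ U → x ∉ W → x ∉ U ∪ W
∉∪⁺ x∉U x∉W x∈U∪W with ∈∪⁻ x∈U∪W
... | inj₁ x∈U = x∉U x∈U
... | inj₂ x∈W = x∉W x∈W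

∪⁅⁆-⊆ : {U X P : VSet n} {x : Fin n} → P ⊆ U ─ X → x ∈ U → P ∪ ⁅ x ⁆ ⊆ U
∪⁅⁆-⊆ P⊆ x∈U y∈ with ∈∪⁻ y∈
... | inj₁ y∈P = proj₁ (∈─⁻ (P⊆ y∈P))
... | inj₂ y∈⁅x⁆ with refl ← x∈⁅y⁆⇒x≡y y∈⁅x⁆ = x∈U

count-∩⁅⁆ : (U : VSet n) (x : Fin n) → count (U ∩ ⁅ x ⁆) ≤ 1
count-∩⁅⁆ U x = ≤-trans (count-mono (proj₂ ∘ ∈∩⁻)) (≤-reflexive (count-⁅⁆ x))

count-remove : {U : VSet n} {x : Fin n} → x ∈ U → count U ≡ suc (count (U - x))
count-remove {U = U} {x} x∈U = begin
  count U                             ≡⟨ count-partition U ⁅ x ⁆ ⟩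
  count (U - x) + count (U ∩ ⁅ x ⁆)   ≡⟨ cong (count (U - x) +_) U∩⁅x⁆≡1 ⟩
  count (U - x) + 1                   ≡⟨ +-comm (count (U - x)) 1 ⟩
  suc (count (U - x))                 ∎
  where
  open ≡-Reasoning
  U∩⁅x⁆≡1 : count (U ∩ ⁅ x ⁆) ≡ 1
  U∩⁅x⁆≡1 = ≤-antisym (count-∩⁅⁆ U x) (≤-trans (≤-reflexive (sym (count-⁅⁆ x))) (count-mono ⁅x⁆⊆U∩⁅x⁆))
    where
    ⁅x⁆⊆U∩⁅x⁆ : ⁅ x ⁆ ⊆ U ∩ ⁅ x ⁆
    ⁅x⁆⊆U∩⁅x⁆ y∈⁅x⁆ with refl ← x∈⁅y⁆⇒x≡y y∈⁅x⁆ = ∈∩⁺ x∈U y∈⁅x⁆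

count≤suc-remove : (U : VSet n) (x : Fin n) → count U ≤ suc (count (U - x))
count≤suc-remove U x = begin
  count U                             ≡⟨ count-partition U ⁅ x ⁆ ⟩
  count (U - x) + count (U ∩ ⁅ x ⁆)   ≤⟨ +-monoʳ-≤ (count (U - x)) (count-∩⁅⁆ U x) ⟩
  count (U - x) + 1                   ≡⟨ +-comm (count (U - x)) 1 ⟩
  suc (count (U - x))                 ∎
  where open ≤-Reasoning

count-─< : {U X : VSet n} → 1 ≤ count (U ∩ X) → count (U ─ X) < count U
count-─< {U = U} {X} 1≤count = begin-strict
  count (U ─ X)                       <⟨ ≤-reflexive (+-comm 1 (count (U ─ X))) ⟩
  count (U ─ X) + 1                   ≤⟨ +-monoʳ-≤ (count (U ─ X)) 1≤count ⟩
  count (U ─ X) + count (U ∩ X)       ≡⟨ count-partition U X ⟨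
  count U                             ∎
  where open ≤-Reasoning

count-pos : {U : VSet n} {x : Fin n} → x ∈ U → 1 ≤ count U
count-pos x∈U = ≤-trans (s≤s z≤n) (≤-reflexive (sym (count-remove x∈U)))

count≥2 : {U : VSet n} {x y : Fin n} → x ∈ U → y ∈ U → x ≢ y → 2 ≤ count U
count≥2 x∈U y∈U x≢y =
  ≤-trans (s≤s (count-pos (∈─⁺ y∈U (x≢y⇒x∉⁅y⁆ (x≢y ∘ sym)))))
          (≤-reflexive (sym (count-remove x∈U)))

count≡1⇒unique : {U : VSet n} {x y : Fin n} → count U ≡ 1 → x ∈ U → y ∈ U → x ≡ y
count≡1⇒unique {x = x} {y} count≡1 x∈U y∈U with x ≟ y
... | yes x≡y = x≡y
... | no x≢y = ⊥-elim (1+n≰n (≤-trans (count≥2 x∈U y∈U x≢y) (≤-reflexive count≡1)))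

unique⇒count≡1 : {U : VSet n} {x : Fin n} → x ∈ U → (∀ {y} → y ∈ U → y ≡ x) → count U ≡ 1
unique⇒count≡1 {U = U} {x} x∈U only-x = trans (count-remove x∈U) (cong suc (count-none {U = U - x} none))
  where
  none : ∀ y → y ∉ U - x
  none y y∈U-x with y∈U , y∉⁅x⁆ ← ∈─⁻ y∈U-x = y∉⁅x⁆ (x≡y⇒x∈⁅y⁆ (only-x y∈U))

count≥2⇒other : {U : VSet n} (x : Fin n) → 2 ≤ count U → ∃ λ y → y ≢ x × y ∈ U
count≥2⇒other {U = U} x 2≤count
  with y , y∈U-x ← count-nonempty {U = U - x} (≤-pred (≤-trans 2≤count (count≤suc-remove U x)))
  with y∈U , y∉⁅x⁆ ← ∈─⁻ y∈U-x = y , y∉⁅x⁆ ∘ x≡y⇒x∈⁅y⁆ , y∈U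

fromList : List (Fin n) → VSet n
fromList [] _ = false
fromList (x ∷ xs) = ⁅ x ⁆ ∪ fromList xs

∈-fromList⁻ : {xs : List (Fin n)} {y : Fin n} → y ∈ fromList xs → y ∈ˡ xs
∈-fromList⁻ {xs = x ∷ xs} y∈ with ∈∪⁻ y∈
... | inj₁ y∈⁅x⁆ = here (x∈⁅y⁆⇒x≡y y∈⁅x⁆)
... | inj₂ y∈xs = there (∈-fromList⁻ y∈xs)

count-fromList : {xs : List (Fin n)} → Unique xs → count (fromList xs) ≡ length xs
count-fromList {xs = []} [] = count-none λ _ ()
count-fromList {xs = x ∷ xs} (x∉xs ∷ u) = begin
  count (⁅ x ⁆ ∪ fromList xs)             ≡⟨ count-remove (∈∪ˡ (x∈⁅x⁆ x)) ⟩
  suc (count ((⁅ x ⁆ ∪ fromList xs) - x)) ≡⟨ cong suc (≤-antisym (count-mono drop) (count-mono keep)) ⟩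
  suc (count (fromList xs))               ≡⟨ cong suc (count-fromList u) ⟩
  suc (length xs)                       ∎
  where
  open ≡-Reasoning
  drop : (⁅ x ⁆ ∪ fromList xs) - x ⊆ fromList xs
  drop y∈ with y∈x∷xs , y∉⁅x⁆ ← ∈─⁻ y∈ with ∈∪⁻ y∈x∷xs
  ... | inj₁ y∈⁅x⁆ = ⊥-elim (y∉⁅x⁆ y∈⁅x⁆)
  ... | inj₂ y∈xs = y∈xs
  keep : fromList xs ⊆ (⁅ x ⁆ ∪ fromList xs) - x
  keep y∈xs = ∈─⁺ (∈∪ʳ y∈xs) λ y∈⁅x⁆ →
    All.All¬⇒¬Any x∉xs (subst (_∈ˡ xs) (x∈⁅y⁆⇒x≡y y∈⁅x⁆) (∈-fromList⁻ y∈xs))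

Unique⇒length≤n : {xs : List (Fin n)} → Unique xs → length xs ≤ n
Unique⇒length≤n {xs = xs} u = subst (_≤ _) (count-fromList u) (count≤n (fromList xs))

module Degrees {n : ℕ} (T : Graph n) where
  open Graph T using (adj; irrfl) renaming (sym to adj-sym)

  infix 4 _~_ _~?_
  _~_ : Fin n → Fin n → Set
  _~_ = Edge T

  _~?_ : (u v : Fin n) → Dec (u ~ v)
  u ~? v = adj u v Bool.≟ true

  ~-sym : {u v : Fin n} → u ~ v → v ~ u
  ~-sym {u} {v} u~v = trans (adj-sym v u) u~v

  ~-irrefl : {v : Fin n} → ¬ v ~ v
  ~-irrefl {v} v~v with () ← trans (sym v~v) (irrfl v)

  deg : VSet n → Fin n → ℕ
  deg U v = count (adj v ∩ U)

  nbr⁺ : {U : VSet n} {v u : Fin n} → v ~ u → u ∈ U → u ∈ adj v ∩ U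
  nbr⁺ v~u = ∈∩⁺ (mem v~u)

  nbr⁻ : {U : VSet n} {v u : Fin n} → u ∈ adj v ∩ U → v ~ u × u ∈ U
  nbr⁻ u∈N with mem v~u , u∈U ← ∈∩⁻ u∈N = v~u , u∈U

  deg-pos : {U : VSet n} {v u : Fin n} → v ~ u → u ∈ U → 1 ≤ deg U v
  deg-pos v~u u∈U = count-pos (nbr⁺ v~u u∈U)

  deg-pos⇒nbr : {U : VSet n} {v : Fin n} → 1 ≤ deg U v → ∃ λ u → v ~ u × u ∈ U
  deg-pos⇒nbr 1≤deg with u , u∈N ← count-nonempty 1≤deg = u , nbr⁻ u∈N

  deg≡1 : {U : VSet n} {v u : Fin n} → v ~ u → u ∈ U → (∀ {w} → v ~ w → w ∈ U → w ≡ u) →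
          deg U v ≡ 1
  deg≡1 v~u u∈U only-u =
    unique⇒count≡1 (nbr⁺ v~u u∈U) λ w∈N → let (v~w , w∈U) = nbr⁻ w∈N in only-u v~w w∈U

  deg≡1⇒unique : {U : VSet n} {v u w : Fin n} →
                 deg U v ≡ 1 → v ~ u → u ∈ U → v ~ w → w ∈ U → u ≡ w
  deg≡1⇒unique deg-v≡1 v~u u∈U v~w w∈U = count≡1⇒unique deg-v≡1 (nbr⁺ v~u u∈U) (nbr⁺ v~w w∈U)

  deg-mono : {P W : VSet n} {v : Fin n} → P ⊆ W → deg P v ≤ deg W v
  deg-mono P⊆W = count-mono λ y∈N → let (v~y , y∈P) = nbr⁻ y∈N in nbr⁺ v~y (P⊆W y∈P)

  deg-cong : {P W : VSet n} {v : Fin n} → P ≗ W → deg P v ≡ deg W v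
  deg-cong P≗W = ≤-antisym (deg-mono λ (mem Py) → mem (trans (sym (P≗W _)) Py))
                           (deg-mono λ (mem Wy) → mem (trans (P≗W _) Wy))

  deg-─ : {U X : VSet n} {z : Fin n} → (∀ {y} → z ~ y → y ∈ U → y ∉ X) →
          deg (U ─ X) z ≡ deg U z
  deg-─ outside = ≤-antisym (deg-mono (proj₁ ∘ ∈─⁻))
    (count-mono λ y∈N → let (z~y , y∈U) = nbr⁻ y∈N in nbr⁺ z~y (∈─⁺ y∈U (outside z~y y∈U)))

  deg-∪⁅⁆ : {P : VSet n} {x v : Fin n} → (v ~ x → x ∈ P) → deg (P ∪ ⁅ x ⁆) v ≡ deg P v
  deg-∪⁅⁆ {P} {x} x∈P = ≤-antisym (count-mono within) (deg-mono ∈∪ˡ)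
    where
    within : adj _ ∩ (P ∪ ⁅ x ⁆) ⊆ adj _ ∩ P
    within y∈N with v~y , y∈P∪x ← nbr⁻ y∈N with ∈∪⁻ y∈P∪x
    ... | inj₁ y∈P = nbr⁺ v~y y∈P
    ... | inj₂ y∈⁅x⁆ with refl ← x∈⁅y⁆⇒x≡y y∈⁅x⁆ = nbr⁺ v~y (x∈P v~y)

  deg-pendant : {U P : VSet n} {v x : Fin n} → deg U v ≡ 1 → v ~ x → x ∈ P → P ⊆ U → deg P v ≡ 1
  deg-pendant deg-v≡1 v~x x∈P P⊆U =
    deg≡1 v~x x∈P λ v~w w∈P → deg≡1⇒unique deg-v≡1 v~w (P⊆U w∈P) v~x (P⊆U x∈P)

  deg-remove : (W : VSet n) (v x : Fin n) → deg W v ≤ deg (W - x) v + bit (adj x v)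
  deg-remove W v x with v ~? x
  ... | no ¬v~x = ≤-trans (count-mono kept) (m≤m+n _ _)
    where
    kept : adj v ∩ W ⊆ adj v ∩ (W - x)
    kept y∈N with v~y , y∈W ← nbr⁻ y∈N =
      nbr⁺ v~y (∈─⁺ y∈W (x≢y⇒x∉⁅y⁆ λ where refl → ¬v~x v~y))
  ... | yes v~x rewrite ~-sym v~x = begin
    count (adj v ∩ W)                 ≤⟨ count≤suc-remove (adj v ∩ W) x ⟩
    suc (count (adj v ∩ W - x))       ≤⟨ s≤s (count-mono shift) ⟩
    suc (deg (W - x) v)               ≡⟨ +-comm 1 _ ⟩
    deg (W - x) v + 1                 ∎
    where
    open ≤-Reasoning
    shift : adj v ∩ W - x ⊆ adj v ∩ (W - x)
    shift y∈ with y∈N , y∉⁅x⁆ ← ∈─⁻ y∈ with v~y , y∈W ← nbr⁻ y∈N =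
      nbr⁺ v~y (∈─⁺ y∈W y∉⁅x⁆)

  opaque
    unfolding count

    ∣N∩∣≡deg : (p : Subset n) (v : Fin n) → Sub.∣ N T v Sub.∩ p ∣ ≡ deg (lookup p) v
    ∣N∩∣≡deg p v = trans (∣p∣≡count (N T v Sub.∩ p)) (count-cong pointwise)
      where
      pointwise : lookup (N T v Sub.∩ p) ≗ adj v ∩ lookup p
      pointwise u = trans (lookup-zipWith _∧_ u (N T v) p) (cong (_∧ lookup p u) (lookup∘tabulate (adj v) u))

-- Support vertices of forests

module Forest {n : ℕ} (T : Graph n) (acyclic : ¬ HasCycle T) where
  open Degrees T
  open import Data.List.Membership.DecPropositional (_≟_ {n}) using () renaming (_∈?_ to _∈ˡ?_)

  Unique-++⁻ˡ : (xs : List (Fin n)) {ys : List (Fin n)} → Unique (xs ++ ys) → Unique xs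
  Unique-++⁻ˡ [] _ = []
  Unique-++⁻ˡ (x ∷ xs) (x∉ ∷ u) = All.++⁻ˡ xs x∉ ∷ Unique-++⁻ˡ xs u

  Chain-++⁻ˡ : (xs : List (Fin n)) (y : Fin n) (zs : List (Fin n)) →
               Chain T (xs ++ y ∷ zs) → Chain T (xs ++ [ y ])
  Chain-++⁻ˡ [] y zs _ = tt
  Chain-++⁻ˡ (x ∷ []) y zs (x~y , _) = x~y , tt
  Chain-++⁻ˡ (x ∷ x′ ∷ xs) y zs (x~x′ , c) = x~x′ , Chain-++⁻ˡ (x′ ∷ xs) y zs c

  Chain-++⁺ : (xs : List (Fin n)) (y : Fin n) (zs : List (Fin n)) →
              Chain T (xs ++ [ y ]) → Chain T (y ∷ zs) → Chain T (xs ++ y ∷ zs)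
  Chain-++⁺ [] y zs _ c = c
  Chain-++⁺ (x ∷ []) y zs (x~y , _) c = x~y , c
  Chain-++⁺ (x ∷ x′ ∷ xs) y zs (x~x′ , c₁) c₂ = x~x′ , Chain-++⁺ (x′ ∷ xs) y zs c₁ c₂

  no-chord : {a b z : Fin n} (r : List (Fin n)) →
             Unique (a ∷ b ∷ r) → Chain T (a ∷ b ∷ r) → a ~ z → z ∉ˡ r
  no-chord {a} {b} {z} r u c a~z z∈r with pre , post , refl ← ∈-∃++ z∈r =
    acyclic (a , b ∷ pre ++ [ z ] , s≤s (length-++-≤ʳ [ z ] {pre}) , unique , cycle)
    where
    unique : Unique (a ∷ b ∷ pre ++ [ z ])
    unique = Unique-++⁻ˡ (a ∷ b ∷ pre ++ [ z ])
               (subst Unique (cong (λ l → a ∷ b ∷ l) (sym (++-assoc pre [ z ] post))) u)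
    cycle : Chain T (a ∷ (b ∷ pre ++ [ z ]) ++ [ a ])
    cycle = subst (λ l → Chain T (a ∷ b ∷ l)) (sym (++-assoc pre [ z ] [ a ]))
              (Chain-++⁺ (a ∷ b ∷ pre) z [ a ] (Chain-++⁻ˡ (a ∷ b ∷ pre) z post c) (~-sym a~z , tt))

  record SupportVertex (U : VSet n) : Set where
    field
      leaf support parent : Fin n
      leaf∈U : leaf ∈ U
      support∈U : support ∈ U
      support~leaf : support ~ leaf
      deg-leaf : deg U leaf ≡ 1
      leaves : ∀ {w} → support ~ w → w ∈ U → w ≢ parent → deg U w ≡ 1

  record Path (U : VSet n) : Set where
    constructor path
    field
      end next : Fin n
      rest : List (Fin n)
      unique : Unique (end ∷ next ∷ rest)
      chain : Chain T (end ∷ next ∷ rest)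
      end∈U : end ∈ U
      next∈U : next ∈ U

    vertices : List (Fin n)
    vertices = end ∷ next ∷ rest

  module _ {U : VSet n} (p : Path U) where
    open Path p

    Extension₁ : Set
    Extension₁ = ∃ λ z → end ~ z × z ∈ U × z ∉ˡ vertices

    -- Replacing `end` by two new vertices: once neither extension exists, `next` is a support vertex.
    Extension₂ : Set
    Extension₂ = ∃ λ w → ∃ λ z →
      (next ~ w × w ∈ U × w ∉ˡ vertices) × (w ~ z × z ∈ U × z ∉ˡ vertices)

    extension₁? : Dec Extension₁
    extension₁? = any? λ z → end ~? z ×-dec z ∈? U ×-dec ¬? (z ∈ˡ? vertices)

    extension₂? : Dec Extension₂
    extension₂? = any? λ w → any? λ z →
      (next ~? w ×-dec w ∈? U ×-dec ¬? (w ∈ˡ? vertices)) ×-dec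
      (w ~? z ×-dec z ∈? U ×-dec ¬? (z ∈ˡ? vertices))

    grow₁ : Extension₁ → Path U
    grow₁ (z , end~z , z∈U , z∉p) =
      path z end (next ∷ rest) (All.¬Any⇒All¬ _ z∉p ∷ unique) (~-sym end~z , chain) z∈U end∈U

    grow₂ : Extension₂ → Path U
    grow₂ (w , z , (next~w , w∈U , w∉p) , (w~z , z∈U , z∉p)) =
      path z w (next ∷ rest)
           ((z≢w ∷ All.¬Any⇒All¬ _ (z∉p ∘ there)) ∷ All.¬Any⇒All¬ _ (w∉p ∘ there) ∷ tail unique)
           (~-sym w~z , ~-sym next~w , proj₂ chain) z∈U w∈U
      where
      z≢w : z ≢ w
      z≢w refl = ~-irrefl w~z

    firstOr : Fin n → List (Fin n) → Fin n
    firstOr d [] = d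
    firstOr _ (r ∷ _) = r

    beyond-parent : ∀ {w} r → Unique (next ∷ r) → Chain T (next ∷ r) → next ~ w → w ∈ˡ r →
                    w ≢ firstOr end r → ⊥
    beyond-parent (r ∷ r′) u c next~w (here refl) w≢r = w≢r refl
    beyond-parent (r ∷ r′) u c next~w (there w∈r′) _ = no-chord r′ u c next~w w∈r′

    module Maximal (¬e₁ : ¬ Extension₁) (¬e₂ : ¬ Extension₂) where
      only-next : ∀ {w} → end ~ w → w ∈ U → w ≡ next
      only-next {w} end~w w∈U with w ∈ˡ? vertices
      ... | no w∉p = ⊥-elim (¬e₁ (w , end~w , w∈U , w∉p))
      ... | yes (here refl) = ⊥-elim (~-irrefl end~w)
      ... | yes (there (here refl)) = refl
      ... | yes (there (there w∈rest)) = ⊥-elim (no-chord rest unique chain end~w w∈rest)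

      deg-end : deg U end ≡ 1
      deg-end = deg≡1 (proj₁ chain) next∈U only-next

      off-path-leaf : ∀ {w} → next ~ w → w ∈ U → w ∉ˡ vertices → deg U w ≡ 1
      off-path-leaf {w} next~w w∈U w∉p = deg≡1 (~-sym next~w) next∈U only-next-w
        where
        only-next-w : ∀ {z} → w ~ z → z ∈ U → z ≡ next
        only-next-w {z} w~z z∈U with z ∈ˡ? vertices
        ... | no z∉p = ⊥-elim (¬e₂ (w , z , (next~w , w∈U , w∉p) , (w~z , z∈U , z∉p)))
        ... | yes (here refl) = ⊥-elim (¬e₁ (w , ~-sym w~z , w∈U , w∉p))
        ... | yes (there (here refl)) = refl
        ... | yes (there (there z∈rest)) =
          ⊥-elim (no-chord rest (All.¬Any⇒All¬ _ (w∉p ∘ there) ∷ tail unique) (~-sym next~w , proj₂ chain)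
                           w~z z∈rest)

      leaves : ∀ {w} → next ~ w → w ∈ U → w ≢ firstOr end rest → deg U w ≡ 1
      leaves {w} next~w w∈U w≢parent with w ∈ˡ? vertices
      ... | yes (here refl) = deg-end
      ... | yes (there (here refl)) = ⊥-elim (~-irrefl next~w)
      ... | yes (there (there w∈rest)) =
        ⊥-elim (beyond-parent rest (tail unique) (proj₂ chain) next~w w∈rest w≢parent)
      ... | no w∉p = off-path-leaf next~w w∈U w∉p

      supportVertex : SupportVertex U
      supportVertex = record
        { leaf = end ; support = next ; parent = firstOr end rest ; leaf∈U = end∈U ; support∈U = next∈U
        ; support~leaf = ~-sym (proj₁ chain) ; deg-leaf = deg-end ; leaves = leaves }

  longestPath : {U : VSet n} (fuel : ℕ) (p : Path U) → n ≤ fuel + length (Path.rest p) → SupportVertex U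
  longestPath zero p n≤length =
    ⊥-elim (<⇒≱ (≤-trans (n≤1+n _) (Unique⇒length≤n (Path.unique p))) n≤length)
  longestPath (suc fuel) p n≤ with extension₁? p
  ... | yes e₁ = longestPath fuel (grow₁ p e₁) (≤-trans n≤ (≤-reflexive (sym (+-suc fuel _))))
  ... | no ¬e₁ with extension₂? p
  ... | yes e₂ = longestPath fuel (grow₂ p e₂) (≤-trans n≤ (≤-reflexive (sym (+-suc fuel _))))
  ... | no ¬e₂ = Maximal.supportVertex p ¬e₁ ¬e₂

  supportVertex : {U : VSet n} {u v : Fin n} → u ~ v → u ∈ U → v ∈ U → SupportVertex U
  supportVertex {u = u} u~v u∈U v∈U =
    longestPath n (path u _ [] ((u≢v ∷ []) ∷ [] ∷ []) (u~v , tt) u∈U v∈U)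
                  (≤-reflexive (sym (+-identityʳ n)))
    where
    u≢v : u ≢ _
    u≢v refl = ~-irrefl u~v

  lowDegree : {U : VSet n} → 1 ≤ count U → ∃ λ x → x ∈ U × deg U x ≤ 1
  lowDegree {U} 1≤count with v , v∈U ← count-nonempty 1≤count with deg U v in deg-v
  ... | zero = v , v∈U , ≤-trans (≤-reflexive deg-v) z≤n
  ... | suc _ with u , v~u , u∈U ← deg-pos⇒nbr {U} {v} (subst (1 ≤_) (sym deg-v) (s≤s z≤n)) =
    leaf , leaf∈U , ≤-reflexive deg-leaf
    where open SupportVertex (supportVertex v~u v∈U u∈U)

-- Perfect domination in forests

module PerfectDomination {n : ℕ} (T : Graph n) (acyclic : ¬ HasCycle T) where
  open Graph T using (adj)
  open Degrees T
  open Forest T acyclic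

  NoIsolated : VSet n → Set
  NoIsolated U = ∀ {v} → v ∈ U → 1 ≤ deg U v

  OneFairIn : VSet n → VSet n → Set
  OneFairIn U P = ∀ {v} → v ∈ U → v ∉ P → deg P v ≡ 1

  PerfectDominating : VSet n → VSet n → Set
  PerfectDominating U P = P ⊆ U × OneFairIn U P

  SmallPerfectDominating : VSet n → Set
  SmallPerfectDominating U = ∃ λ P → PerfectDominating U P × count P + count P ≤ count U

  record Reduction (U : VSet n) : Set where
    field
      removed : VSet n
      removed≥2 : 2 ≤ count (U ∩ removed)
      remainder-noIsolated : NoIsolated (U ─ removed)
      extend : ∀ {P} → PerfectDominating (U ─ removed) P →
               ∃ λ x → x ∈ U × OneFairIn U (P ∪ ⁅ x ⁆)

  reduce : {U : VSet n} (r : Reduction U) → SmallPerfectDominating (U ─ Reduction.removed r) →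
           SmallPerfectDominating U
  reduce {U} r (P , (P⊆ , P-fair) , small) with x , x∈U , fair ← Reduction.extend r (P⊆ , P-fair) =
    P ∪ ⁅ x ⁆ , (∪⁅⁆-⊆ P⊆ x∈U , fair) , size
    where
    open Reduction r
    open ≤-Reasoning
    ≤1+ : count (P ∪ ⁅ x ⁆) ≤ suc (count P)
    ≤1+ = ≤-trans (count-∪ P ⁅ x ⁆)
                  (≤-reflexive (trans (cong (count P +_) (count-⁅⁆ x)) (+-comm (count P) 1)))
    size : count (P ∪ ⁅ x ⁆) + count (P ∪ ⁅ x ⁆) ≤ count U
    size = begin
      count (P ∪ ⁅ x ⁆) + count (P ∪ ⁅ x ⁆)      ≤⟨ +-mono-≤ ≤1+ ≤1+ ⟩
      suc (count P) + suc (count P)              ≡⟨ cong suc (+-suc (count P) (count P)) ⟩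
      2 + (count P + count P)                    ≤⟨ +-mono-≤ removed≥2 small ⟩
      count (U ∩ removed) + count (U ─ removed)  ≡⟨ +-comm _ (count (U ─ removed)) ⟩
      count (U ─ removed) + count (U ∩ removed)  ≡⟨ count-partition U removed ⟨
      count U                                    ∎

  module Reductions {U : VSet n} (noIsolated : NoIsolated U) (sv : SupportVertex U) where
    open SupportVertex sv

    support≢leaf : support ≢ leaf
    support≢leaf refl = ~-irrefl support~leaf

    unaffected : {X : VSet n} {z : Fin n} → z ∈ U → (∀ {y} → z ~ y → y ∈ U → y ∉ X) →
                 1 ≤ deg (U ─ X) z
    unaffected z∈U outside = subst (1 ≤_) (sym (deg-─ outside)) (noIsolated z∈U)

    module Star (all-leaves : ∀ {w} → support ~ w → w ∈ U → deg U w ≡ 1) where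
      X : VSet n
      X = ⁅ support ⁆ ∪ adj support

      remainder-noIsolated : NoIsolated (U ─ X)
      remainder-noIsolated {z} z∈U─X with z∈U , z∉X ← ∈─⁻ z∈U─X = unaffected z∈U outside
        where
        outside : ∀ {y} → z ~ y → y ∈ U → y ∉ X
        outside z~y y∈U y∈X with ∈∪⁻ y∈X
        ... | inj₁ y∈⁅s⁆ with refl ← x∈⁅y⁆⇒x≡y y∈⁅s⁆ = z∉X (∈∪ʳ (mem (~-sym z~y)))
        ... | inj₂ (mem s~y)
          with refl ← deg≡1⇒unique (all-leaves s~y y∈U) (~-sym z~y) z∈U (~-sym s~y) support∈U =
          z∉X (∈∪ˡ (x∈⁅x⁆ support))

      extend : ∀ {P} → PerfectDominating (U ─ X) P → ∃ λ x → x ∈ U × OneFairIn U (P ∪ ⁅ x ⁆)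
      extend {P} (P⊆ , P-fair) = support , support∈U , fair
        where
        fair : OneFairIn U (P ∪ ⁅ support ⁆)
        fair {v} v∈U v∉ with support ~? v
        ... | yes s~v =
          deg-pendant (all-leaves s~v v∈U) (~-sym s~v) (∈∪ʳ (x∈⁅x⁆ support)) (∪⁅⁆-⊆ P⊆ support∈U)
        ... | no ¬s~v = trans (deg-∪⁅⁆ (⊥-elim ∘ ¬s~v ∘ ~-sym))
                              (P-fair (∈─⁺ v∈U (∉∪⁺ (v∉ ∘ ∈∪ʳ) (¬s~v ∘ unmem))) (v∉ ∘ ∈∪ˡ))

      reduction : Reduction U
      reduction = record
        { removed = X
        ; removed≥2 =
            count≥2 (∈∩⁺ support∈U (∈∪ˡ (x∈⁅x⁆ support))) (∈∩⁺ leaf∈U (∈∪ʳ (mem support~leaf))) support≢leaf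
        ; remainder-noIsolated = remainder-noIsolated
        ; extend = extend }

    twigs : VSet n
    twigs = adj support ∩ U - parent

    twig⁺ : ∀ {y} → support ~ y → y ∈ U → y ≢ parent → y ∈ twigs
    twig⁺ s~y y∈U y≢p = ∈─⁺ (nbr⁺ s~y y∈U) (x≢y⇒x∉⁅y⁆ y≢p)

    twig⁻ : ∀ {y} → y ∈ twigs → support ~ y × y ∈ U × y ≢ parent
    twig⁻ y∈L with y∈N , y∉⁅p⁆ ← ∈─⁻ y∈L with s~y , y∈U ← nbr⁻ y∈N =
      s~y , y∈U , y∉⁅p⁆ ∘ x≡y⇒x∈⁅y⁆

    non-twig : ∀ {y} → support ~ y → y ∈ U → y ∉ twigs → y ≡ parent
    non-twig {y} s~y y∈U y∉L with y ≟ parent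
    ... | yes y≡p = y≡p
    ... | no y≢p = ⊥-elim (y∉L (twig⁺ s~y y∈U y≢p))

    twig-deg : ∀ {y} → y ∈ twigs → deg U y ≡ 1
    twig-deg y∈L = let (s~y , y∈U , y≢p) = twig⁻ y∈L in leaves s~y y∈U y≢p

    twig-nbr : ∀ {y z} → y ∈ twigs → y ~ z → z ∈ U → z ≡ support
    twig-nbr y∈L y~z z∈U =
      let (s~y , _ , _) = twig⁻ y∈L in deg≡1⇒unique (twig-deg y∈L) y~z z∈U (~-sym s~y) support∈U

    leaf≢parent : deg U parent ≢ 1 → leaf ≢ parent
    leaf≢parent deg≢1 refl = deg≢1 deg-leaf

    leaf-nbr : ∀ {y} → leaf ~ y → y ∈ U → y ≡ support
    leaf-nbr leaf~y y∈U = deg≡1⇒unique deg-leaf leaf~y y∈U (~-sym support~leaf) support∈U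

    leaf∈twigs : deg U parent ≢ 1 → leaf ∈ twigs
    leaf∈twigs deg≢1 = twig⁺ support~leaf leaf∈U (leaf≢parent deg≢1)

    support∈U─twigs : support ∈ U ─ twigs
    support∈U─twigs = ∈─⁺ support∈U λ s∈L → ~-irrefl (proj₁ (twig⁻ s∈L))

    module Broom (p∈U : parent ∈ U) (s~p : support ~ parent) (twigs≥2 : 2 ≤ count twigs) where
      remainder-noIsolated : NoIsolated (U ─ twigs)
      remainder-noIsolated {z} z∈U─L with z∈U , z∉L ← ∈─⁻ z∈U─L with z ≟ support
      ... | yes refl = deg-pos s~p (∈─⁺ p∈U λ p∈L → proj₂ (proj₂ (twig⁻ p∈L)) refl)
      ... | no z≢s = unaffected z∈U λ z~y y∈U y∈L → z≢s (twig-nbr y∈L (~-sym z~y) z∈U)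

      extend : ∀ {P} → PerfectDominating (U ─ twigs) P → ∃ λ x → x ∈ U × OneFairIn U (P ∪ ⁅ x ⁆)
      extend {P} (P⊆ , P-fair) = support , support∈U , fair
        where
        fair : OneFairIn U (P ∪ ⁅ support ⁆)
        fair {v} v∈U v∉ with v ∈? twigs
        ... | yes v∈L =
          deg-pendant (twig-deg v∈L) (~-sym (proj₁ (twig⁻ v∈L))) (∈∪ʳ (x∈⁅x⁆ support))
                      (∪⁅⁆-⊆ P⊆ support∈U)
        ... | no v∉L = trans (deg-∪⁅⁆ support∈P) (P-fair (∈─⁺ v∈U v∉L) (v∉ ∘ ∈∪ˡ))
          where
          -- otherwise the unique P-neighbour of support would be, like v, its parent
          support∈P : v ~ support → support ∈ P
          support∈P v~s with support ∈? P
          ... | yes s∈P = s∈P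
          ... | no s∉P
            with i , s~i , i∈P ← deg-pos⇒nbr (≤-reflexive (sym (P-fair support∈U─twigs s∉P)))
            with i∈U , i∉L ← ∈─⁻ (P⊆ i∈P)
            with refl ← non-twig s~i i∈U i∉L | refl ← non-twig (~-sym v~s) v∈U v∉L = ⊥-elim (v∉ (∈∪ˡ i∈P))

      reduction : Reduction U
      reduction = record
        { removed = twigs
        ; removed≥2 = ≤-trans twigs≥2 (count-mono λ y∈L → ∈∩⁺ (proj₁ (proj₂ (twig⁻ y∈L))) y∈L)
        ; remainder-noIsolated = remainder-noIsolated
        ; extend = extend }

    module PathEnd (p∈U : parent ∈ U) (s~p : support ~ parent) (deg≢1 : deg U parent ≢ 1)
                   (twigs≡1 : count twigs ≡ 1) where
      X : VSet n
      X = ⁅ leaf ⁆ ∪ ⁅ support ⁆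

      outside⁻ : ∀ {z} → z ∉ X → z ≢ leaf × z ≢ support
      outside⁻ z∉X = z∉X ∘ ∈∪ˡ ∘ x≡y⇒x∈⁅y⁆ , z∉X ∘ ∈∪ʳ ∘ x≡y⇒x∈⁅y⁆

      outside⁺ : ∀ {z} → z ≢ leaf → z ≢ support → z ∉ X
      outside⁺ z≢ℓ z≢s = ∉∪⁺ (x≢y⇒x∉⁅y⁆ z≢ℓ) (x≢y⇒x∉⁅y⁆ z≢s)

      support-nbr : ∀ {y} → support ~ y → y ∈ U → y ≡ leaf ⊎ y ≡ parent
      support-nbr {y} s~y y∈U with y ∈? twigs
      ... | yes y∈L = inj₁ (count≡1⇒unique twigs≡1 y∈L (leaf∈twigs deg≢1))
      ... | no y∉L = inj₂ (non-twig s~y y∈U y∉L)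

      remainder-noIsolated : NoIsolated (U ─ X)
      remainder-noIsolated {z} z∈U─X
        with z∈U , z∉X ← ∈─⁻ z∈U─X with z≢ℓ , z≢s ← outside⁻ z∉X with z ≟ parent
      ... | yes refl
        with y , y≢s , y∈N ← count≥2⇒other support (≤∧≢⇒< (deg-pos (~-sym s~p) support∈U) (deg≢1 ∘ sym))
        with p~y , y∈U ← nbr⁻ y∈N =
        deg-pos p~y (∈─⁺ y∈U (outside⁺ (λ where refl → z≢s (leaf-nbr (~-sym p~y) z∈U)) y≢s))
      ... | no z≢p = unaffected z∈U outside
        where
        outside : ∀ {y} → z ~ y → y ∈ U → y ∉ X
        outside z~y y∈U y∈X with ∈∪⁻ y∈X
        ... | inj₁ y∈⁅ℓ⁆ with refl ← x∈⁅y⁆⇒x≡y y∈⁅ℓ⁆ = z≢s (leaf-nbr (~-sym z~y) z∈U)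
        ... | inj₂ y∈⁅s⁆ with refl ← x∈⁅y⁆⇒x≡y y∈⁅s⁆ with support-nbr (~-sym z~y) z∈U
        ...   | inj₁ z≡ℓ = z≢ℓ z≡ℓ
        ...   | inj₂ z≡p = z≢p z≡p

      extend : ∀ {P} → PerfectDominating (U ─ X) P → ∃ λ x → x ∈ U × OneFairIn U (P ∪ ⁅ x ⁆)
      extend {P} (P⊆ , P-fair) with parent ∈? P
      ... | yes p∈P = support , support∈U , fair
        where
        fair : OneFairIn U (P ∪ ⁅ support ⁆)
        fair {v} v∈U v∉ with v ≟ leaf
        ... | yes refl =
          deg-pendant deg-leaf (~-sym support~leaf) (∈∪ʳ (x∈⁅x⁆ support)) (∪⁅⁆-⊆ P⊆ support∈U)
        ... | no v≢ℓ = trans (deg-∪⁅⁆ (⊥-elim ∘ v≁s))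
                             (P-fair (∈─⁺ v∈U (outside⁺ v≢ℓ (v∉ ∘ ∈∪ʳ ∘ x≡y⇒x∈⁅y⁆))) (v∉ ∘ ∈∪ˡ))
          where
          v≁s : ¬ v ~ support
          v≁s v~s with support-nbr (~-sym v~s) v∈U
          ... | inj₁ v≡ℓ = v≢ℓ v≡ℓ
          ... | inj₂ refl = v∉ (∈∪ˡ p∈P)
      ... | no p∉P = leaf , leaf∈U , fair
        where
        fair : OneFairIn U (P ∪ ⁅ leaf ⁆)
        fair {v} v∈U v∉ with v ≟ support
        ... | yes refl = deg≡1 support~leaf (∈∪ʳ (x∈⁅x⁆ leaf)) only-leaf
          where
          only-leaf : ∀ {w} → support ~ w → w ∈ P ∪ ⁅ leaf ⁆ → w ≡ leaf
          only-leaf s~w w∈ with support-nbr s~w (∪⁅⁆-⊆ P⊆ leaf∈U w∈)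
          ... | inj₁ w≡ℓ = w≡ℓ
          ... | inj₂ refl with ∈∪⁻ w∈
          ...   | inj₁ p∈P = ⊥-elim (p∉P p∈P)
          ...   | inj₂ p∈⁅ℓ⁆ = x∈⁅y⁆⇒x≡y p∈⁅ℓ⁆
        ... | no v≢s = trans (deg-∪⁅⁆ λ v~ℓ → ⊥-elim (v≢s (leaf-nbr (~-sym v~ℓ) v∈U)))
                             (P-fair (∈─⁺ v∈U (outside⁺ (v∉ ∘ ∈∪ʳ ∘ x≡y⇒x∈⁅y⁆) v≢s)) (v∉ ∘ ∈∪ˡ))

      reduction : Reduction U
      reduction = record
        { removed = X
        ; removed≥2 =
            count≥2 (∈∩⁺ leaf∈U (∈∪ˡ (x∈⁅x⁆ leaf))) (∈∩⁺ support∈U (∈∪ʳ (x∈⁅x⁆ support))) (support≢leaf ∘ sym)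
        ; remainder-noIsolated = remainder-noIsolated
        ; extend = extend }

    -- Either all neighbours of the support vertex are leaves, or its parent is not a leaf and
    -- it has exactly one (path end) or at least two (broom) leaves besides.
    reduction : Reduction U
    reduction with parent ∈? U ×-dec support ~? parent ×-dec ¬? (deg U parent ℕ.≟ 1)
    ... | yes (p∈U , s~p , deg≢1) with count twigs ℕ.≟ 1
    ...   | yes twigs≡1 = PathEnd.reduction p∈U s~p deg≢1 twigs≡1
    ...   | no twigs≢1 = Broom.reduction p∈U s~p (≤∧≢⇒< (count-pos (leaf∈twigs deg≢1)) (twigs≢1 ∘ sym))
    reduction | no ¬non-leaf-parent = Star.reduction all-leaves
      where
      all-leaves : ∀ {w} → support ~ w → w ∈ U → deg U w ≡ 1
      all-leaves {w} s~w w∈U with w ≟ parent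
      ... | no w≢p = leaves s~w w∈U w≢p
      ... | yes refl with deg U w ℕ.≟ 1
      ...   | yes deg-w≡1 = deg-w≡1
      ...   | no deg-w≢1 = ⊥-elim (¬non-leaf-parent (w∈U , s~w , deg-w≢1))

  smallPerfectDominating : (U : VSet n) → NoIsolated U → SmallPerfectDominating U
  smallPerfectDominating U = go U (<-wellFounded (count U))
    where
    go : (U : VSet n) → Acc _<_ (count U) → NoIsolated U → SmallPerfectDominating U
    go U (acc smaller) noIsolated with any? (_∈? U)
    ... | no empty =
      U , ((λ v∈U → v∈U) , λ v∈U v∉U → ⊥-elim (v∉U v∈U)) , subst (λ c → c + c ≤ c) (sym U≡0) z≤n
      where U≡0 = count-none λ x x∈U → empty (x , x∈U)
    ... | yes (v , v∈U) with u , v~u , u∈U ← deg-pos⇒nbr (noIsolated v∈U) =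
      reduce r (go (U ─ removed) (smaller (count-─< (≤-trans (n≤1+n 1) removed≥2))) remainder-noIsolated)
      where
      r = Reductions.reduction noIsolated (supportVertex v~u v∈U u∈U)
      open Reduction r

-- Edges leaving a vertex set in a forest

module Cut {n : ℕ} (T : Graph n) (acyclic : ¬ HasCycle T) (D : VSet n) where
  open Graph T using (adj)
  open Degrees T
  open Forest T acyclic

  -- cut U counts the edges of T inside U that join U ─ D to D, from their end in U ─ D.
  crossDeg : VSet n → Fin n → ℕ
  crossDeg U v = bit ((U ─ D) v) * deg (D ∩ U) v

  cut : VSet n → ℕ
  cut U = sum (crossDeg U)

  crossDeg-≤ : {U U′ : VSet n} {v : Fin n} (c : ℕ) →
               (v ∈ U ─ D → v ∈ U′ ─ D × deg (D ∩ U) v ≤ deg (D ∩ U′) v + c) →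
               crossDeg U v ≤ crossDeg U′ v + c
  crossDeg-≤ {U} {U′} {v} c bound with v ∈? U ─ D
  ... | no v∉ = ≤-trans (≤-reflexive (cong (_* deg (D ∩ U) v) (bit-∉ v∉))) z≤n
  ... | yes v∈ with v∈′ , deg≤ ← bound v∈ = begin
    bit ((U ─ D) v) * deg (D ∩ U) v        ≡⟨ cong (_* deg (D ∩ U) v) (bit-∈ v∈) ⟩
    1 * deg (D ∩ U) v                      ≡⟨ *-identityˡ _ ⟩
    deg (D ∩ U) v                          ≤⟨ deg≤ ⟩
    deg (D ∩ U′) v + c                     ≡⟨ cong (_+ c) (*-identityˡ _) ⟨
    1 * deg (D ∩ U′) v + c                 ≡⟨ cong (λ b → b * deg (D ∩ U′) v + c) (bit-∈ v∈′) ⟨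
    bit ((U′ ─ D) v) * deg (D ∩ U′) v + c  ∎
    where open ≤-Reasoning

  cut-remove∈D : {U : VSet n} {x : Fin n} → x ∈ D → cut U ≤ cut (U - x) + deg U x
  cut-remove∈D {U} {x} x∈D = begin
    cut U
      ≤⟨ sum-mono-≤ pointwise ⟩
    sum (λ v → crossDeg (U - x) v + bit ((adj x ∩ U) v))
      ≡⟨ ∑-distrib-+ (crossDeg (U - x)) (bit ∘ (adj x ∩ U)) ⟩
    cut (U - x) + sum (bit ∘ (adj x ∩ U))
      ≡⟨ cong (cut (U - x) +_) (count≡sum (adj x ∩ U)) ⟨
    cut (U - x) + deg U x
      ∎
    where
    open ≤-Reasoning
    shift : D ∩ U - x ⊆ D ∩ (U - x)
    shift y∈ with y∈D∩U , y∉⁅x⁆ ← ∈─⁻ y∈ with y∈D , y∈U ← ∈∩⁻ y∈D∩U =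
      ∈∩⁺ y∈D (∈─⁺ y∈U y∉⁅x⁆)
    pointwise : ∀ v → crossDeg U v ≤ crossDeg (U - x) v + bit ((adj x ∩ U) v)
    pointwise v = crossDeg-≤ _ λ v∈U─D → let (v∈U , v∉D) = ∈─⁻ v∈U─D in
      ∈─⁺ (∈─⁺ v∈U (x≢y⇒x∉⁅y⁆ λ where refl → v∉D x∈D)) v∉D ,
      ≤-trans (deg-remove (D ∩ U) v x) (+-mono-≤ (deg-mono shift) (bit-mono λ x~v → ∈∩⁺ x~v v∈U))

  cut-remove∉D : {U : VSet n} {x : Fin n} → x ∉ D → cut U ≤ cut (U - x) + deg U x
  cut-remove∉D {U} {x} x∉D = begin
    cut U
      ≤⟨ sum-mono-≤ pointwise ⟩
    sum (λ v → crossDeg (U - x) v + bit (⁅ x ⁆ v) * deg U x)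
      ≡⟨ ∑-distrib-+ (crossDeg (U - x)) (λ v → bit (⁅ x ⁆ v) * deg U x) ⟩
    cut (U - x) + sum (λ v → bit (⁅ x ⁆ v) * deg U x)
      ≡⟨ cong (cut (U - x) +_) (*-distribʳ-sum (deg U x) (bit ∘ ⁅ x ⁆)) ⟨
    cut (U - x) + sum (bit ∘ ⁅ x ⁆) * deg U x
      ≡⟨ cong (λ c → cut (U - x) + c * deg U x) (trans (sym (count≡sum ⁅ x ⁆)) (count-⁅⁆ x)) ⟩
    cut (U - x) + 1 * deg U x
      ≡⟨ cong (cut (U - x) +_) (*-identityˡ _) ⟩
    cut (U - x) + deg U x
      ∎
    where
    open ≤-Reasoning
    same : D ∩ U ⊆ D ∩ (U - x)
    same y∈ with y∈D , y∈U ← ∈∩⁻ y∈ =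
      ∈∩⁺ y∈D (∈─⁺ y∈U (x≢y⇒x∉⁅y⁆ λ where refl → x∉D y∈D))
    pointwise : ∀ v → crossDeg U v ≤ crossDeg (U - x) v + bit (⁅ x ⁆ v) * deg U x
    pointwise v with v ≟ x
    ... | yes refl = begin
      bit ((U ─ D) x) * deg (D ∩ U) x
        ≤⟨ *-mono-≤ (bit≤1 ((U ─ D) x)) (deg-mono {P = D ∩ U} (proj₂ ∘ ∈∩⁻)) ⟩
      1 * deg U x                                   ≡⟨ cong (_* deg U x) (bit-∈ (x∈⁅x⁆ x)) ⟨
      bit (⁅ x ⁆ x) * deg U x                       ≤⟨ m≤n+m _ _ ⟩
      crossDeg (U - x) x + bit (⁅ x ⁆ x) * deg U x  ∎
    ... | no v≢x = ≤-trans (crossDeg-≤ 0 λ v∈U─D → let (v∈U , v∉D) = ∈─⁻ v∈U─D in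
                              ∈─⁺ (∈─⁺ v∈U (x≢y⇒x∉⁅y⁆ v≢x)) v∉D , ≤-trans (deg-mono same) (m≤m+n _ 0))
                           (+-monoʳ-≤ _ z≤n)

  cut-remove : {U : VSet n} {x : Fin n} → cut U ≤ cut (U - x) + deg U x
  cut-remove {x = x} with x ∈? D
  ... | yes x∈D = cut-remove∈D x∈D
  ... | no x∉D = cut-remove∉D x∉D

  cut-none : {U : VSet n} → (∀ x → x ∉ U) → cut U ≡ 0
  cut-none {U} none =
    trans (sum-cong-≗ λ v → cong (_* deg (D ∩ U) v) (bit-∉ (none v ∘ proj₁ ∘ ∈─⁻)))
          (sum-replicate-zero n)

  cut≤count∸1 : (U : VSet n) → cut U ≤ count U ∸ 1
  cut≤count∸1 U = go U (<-wellFounded (count U))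
    where
    go : (U : VSet n) → Acc _<_ (count U) → cut U ≤ count U ∸ 1
    go U (acc smaller) with any? (_∈? U)
    ... | no empty = ≤-trans (≤-reflexive (cut-none λ x x∈U → empty (x , x∈U))) z≤n
    ... | yes (v , v∈U) with x , x∈U , deg≤1 ← lowDegree (count-pos v∈U) = begin
      cut U                          ≤⟨ cut-remove ⟩
      cut (U - x) + deg U x          ≤⟨ +-monoˡ-≤ (deg U x) (go (U - x) (smaller U-x<U)) ⟩
      count (U - x) ∸ 1 + deg U x    ≤⟨ m∸1+n≤m deg≤1 (count-mono nbrs-remain) ⟩
      count (U - x)                  ≡⟨ cong (_∸ 1) (count-remove x∈U) ⟨
      count U ∸ 1                    ∎
      where
      open ≤-Reasoning
      U-x<U : count (U - x) < count U
      U-x<U = ≤-reflexive (sym (count-remove x∈U))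
      nbrs-remain : adj x ∩ U ⊆ U - x
      nbrs-remain y∈N with x~y , y∈U ← nbr⁻ y∈N =
        ∈─⁺ y∈U (x≢y⇒x∉⁅y⁆ λ where refl → ~-irrefl x~y)

  cut-full : {k : ℕ} → (∀ {v} → v ∉ D → deg D v ≡ k) → cut full ≡ count (not ∘ D) * k
  cut-full {k} k-fair = begin
    cut full                          ≡⟨ sum-cong-≗ pointwise ⟩
    sum (λ v → bit (not (D v)) * k)   ≡⟨ *-distribʳ-sum k (bit ∘ not ∘ D) ⟨
    sum (bit ∘ not ∘ D) * k           ≡⟨ cong (_* k) (count≡sum (not ∘ D)) ⟨
    count (not ∘ D) * k               ∎
    where
    open ≡-Reasoning
    pointwise : ∀ v → crossDeg full v ≡ bit (not (D v)) * k
    pointwise v with v ∈? D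
    ... | yes v∈D = trans (cong (_* deg (D ∩ full) v) (bit-∉ λ v∈ → proj₂ (∈─⁻ v∈) v∈D))
                          (sym (cong (λ b → bit (not b) * k) (unmem v∈D)))
    ... | no v∉D =
      cong₂ _*_ (trans (bit-∈ (∈─⁺ (mem refl) v∉D)) (sym (cong (bit ∘ not) (∉⇒false v∉D))))
                (trans (≤-antisym (deg-mono (proj₁ ∘ ∈∩⁻)) (deg-mono λ y∈D → ∈∩⁺ y∈D (mem refl))) (k-fair v∉D))

  fair⇒cut-bound : {k : ℕ} → (∀ {v} → v ∉ D → deg D v ≡ k) → Fin n → count (not ∘ D) * k < n
  fair⇒cut-bound k-fair v =
    ≤∸1⇒< (subst₂ (λ c m → c ≤ m ∸ 1) (cut-full k-fair) count-full (cut≤count∸1 full))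
          (≤-trans (s≤s z≤n) (toℕ<n v))

-- Fair domination in trees

module Tree {n : ℕ} (T : Graph n) (connected : Connected T) (acyclic : ¬ HasCycle T) where
  open Degrees T
  open PerfectDomination T acyclic

  reach-nbr : {w v u : Fin n} → Reach T w v → v ~ u → ∃ (w ~_)
  reach-nbr here v~u = _ , v~u
  reach-nbr (step w~x _) _ = _ , w~x

  connected⇒noIsolated : {v u : Fin n} → v ~ u → NoIsolated full
  connected⇒noIsolated v~u {w} _ with u , w~u ← reach-nbr (connected w _) v~u = deg-pos w~u (mem refl)

  oneFair⇒IsFD : {P : VSet n} → OneFairIn full P → IsFD T (tabulate P)
  oneFair⇒IsFD {P} P-fair = 1 , ≤-refl , dominating , one-fair
    where
    ∈⇒∈ˢ : ∀ {v} → v ∈ P → v Sub.∈ tabulate P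
    ∈⇒∈ˢ {v} (mem Pv) = lookup⇒[]= v (tabulate P) (trans (lookup∘tabulate P v) Pv)
    outside-deg : ∀ {v} → v Sub.∉ tabulate P → deg P v ≡ 1
    outside-deg v∉ = P-fair (mem refl) (v∉ ∘ ∈⇒∈ˢ)
    dominating : Dominating T (tabulate P)
    dominating v v∉ with u , v~u , u∈P ← deg-pos⇒nbr (≤-reflexive (sym (outside-deg v∉))) =
      u , ∈⇒∈ˢ u∈P , v~u
    one-fair : ∀ v → v Sub.∉ tabulate P → Sub.∣ N T v Sub.∩ tabulate P ∣ ≡ 1
    one-fair v v∉ =
      trans (∣N∩∣≡deg (tabulate P) v) (trans (deg-cong (lookup∘tabulate P)) (outside-deg v∉))

  minimum≤half : (D : Subset n) → IsMinFD T D → {v u : Fin n} → v ~ u →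
                 count (lookup D) + count (lookup D) ≤ n
  minimum≤half D (_ , minimum) v~u
    with P , (_ , P-fair) , small ← smallPerfectDominating full (connected⇒noIsolated v~u) =
    ≤-trans (+-mono-≤ |D|≤|P| |D|≤|P|) (subst (count P + count P ≤_) count-full small)
    where
    |D|≤|P| : count (lookup D) ≤ count P
    |D|≤|P| = subst₂ _≤_ (∣p∣≡count D) (trans (∣p∣≡count (tabulate P)) (count-cong (lookup∘tabulate P)))
                     (minimum (tabulate P) (oneFair⇒IsFD P-fair))

fair-arith : (d s : ℕ) {k : ℕ} → 2 ≤ k → s * k < d + s → d + d ≤ d + s → ⊥
fair-arith d s {k} 2≤k sk<d+s 2d≤d+s = <⇒≱ sk<d+s $ begin
  d + s        ≤⟨ +-monoˡ-≤ s (+-cancelˡ-≤ d d s 2d≤d+s) ⟩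
  s + s        ≡⟨ cong (s +_) (+-identityʳ s) ⟨
  2 * s        ≡⟨ *-comm 2 s ⟩
  s * 2        ≤⟨ *-monoʳ-≤ s 2≤k ⟩
  s * k        ∎
  where open ≤-Reasoning

mainTheorem12 : (n : ℕ) (T : Graph n) → IsTree T →
    (D : Subset n) → IsMinFD T D → IsKFair T 1 D
mainTheorem12 n T (connected , acyclic) D min@((k , 1≤k , dominating , k-fair) , _) = dominating , one-fair
  where
  open Degrees T
  Dᵛ : VSet n
  Dᵛ = lookup D
  one-fair : ∀ v → v Sub.∉ D → Sub.∣ N T v Sub.∩ D ∣ ≡ 1
  one-fair v v∉D with k ℕ.≟ 1 | dominating v v∉D
  ... | yes refl | _ = k-fair v v∉D
  ... | no k≢1 | _ , _ , v~u =
    ⊥-elim (fair-arith (count Dᵛ) (count (not ∘ Dᵛ)) (≤∧≢⇒< 1≤k (k≢1 ∘ sym)) cut-bound half-bound)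
    where
    k-fairᵛ : ∀ {w} → w ∉ Dᵛ → deg Dᵛ w ≡ k
    k-fairᵛ {w} w∉ = trans (sym (∣N∩∣≡deg D w)) (k-fair w (w∉ ∘ mem ∘ []=⇒lookup))
    cut-bound : count (not ∘ Dᵛ) * k < count Dᵛ + count (not ∘ Dᵛ)
    cut-bound = subst (count (not ∘ Dᵛ) * k <_) (sym (count-∁ Dᵛ))
                      (Cut.fair⇒cut-bound T acyclic Dᵛ k-fairᵛ v)
    half-bound : count Dᵛ + count Dᵛ ≤ count Dᵛ + count (not ∘ Dᵛ)
    half-bound = subst (count Dᵛ + count Dᵛ ≤_) (sym (count-∁ Dᵛ))
                       (Tree.minimum≤half T connected acyclic D min v~u)
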